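{- Let $\hat A=(A,\Delta A,\oplus,+,0)$ be a change action. The following are equivalent: (i) $\hat A$ is transitive; (ii) there is a difference operator for $\hat A$; (iii) for every change action $\hat B$, every function $f:B\to A$ is differentiable (as a function from $\hat B$ to $\hat A$).
   Context: A change action $\hat A=(A,\Delta A,\oplus,+,0)$ consists of a set $A$, a monoid $(\Delta A,+,0)$ and a map $\oplus:A\times\Delta A\to A$ with $a\oplus 0=a$ and $a\oplus(\delta_1+\delta_2)=(a\oplus\delta_1)\oplus\delta_2$. It is transitive if for all $a,b\in A$ there is $\delta\in\Delta A$ with $a\oplus\delta=b$. A difference operator is a function $\ominus:A\times A\to\Delta A$ with $a\oplus(b\ominus a)=b$ for all $a,b$. For change actions $\hat B,\hat A$, a function $f:B\to A$ is differentiable if there is $\partial f:B\times\Delta B\to\Delta A$ with $f(b\oplus_B\delta)=f(b)\oplus_A\partial f(b,\delta)$ for all $b,\delta$. -}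

module Defs where

open import Level using (Level; suc; _⊔_)
open import Relation.Binary.PropositionalEquality using (_≡_)
open import Algebra.Structures using (IsMonoid)
open import Data.Product using (Σ; ∃)

record ChangeAction (ℓ : Level) : Set (suc ℓ) where
  infixl 6 _⊕_
  infixl 7 _+_
  field
    A        : Set ℓ
    ΔA       : Set ℓ
    _⊕_      : A → ΔA → A
    _+_      : ΔA → ΔA → ΔA
    0Δ       : ΔA
    isMonoid : IsMonoid _≡_ _+_ 0Δ
    ⊕-zero   : ∀ a → a ⊕ 0Δ ≡ a
    ⊕-plus   : ∀ a δ₁ δ₂ → a ⊕ (δ₁ + δ₂) ≡ (a ⊕ δ₁) ⊕ δ₂

open ChangeAction public

Transitive : ∀ {ℓ} → ChangeAction ℓ → Set ℓ
Transitive Â = ∀ (a b : A Â) → Σ (ΔA Â) (λ δ → _⊕_ Â a δ ≡ b)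

IsDifferenceOperator : ∀ {ℓ} (Â : ChangeAction ℓ) → (A Â → A Â → ΔA Â) → Set ℓ
IsDifferenceOperator Â _⊖_ = ∀ (a b : A Â) → _⊕_ Â a (b ⊖ a) ≡ b

HasDifferenceOperator : ∀ {ℓ} → ChangeAction ℓ → Set ℓ
HasDifferenceOperator Â = Σ (A Â → A Â → ΔA Â) (IsDifferenceOperator Â)

IsDerivative : ∀ {ℓ₁ ℓ₂} (B̂ : ChangeAction ℓ₁) (Â : ChangeAction ℓ₂)
  (f : A B̂ → A Â) → (A B̂ → ΔA B̂ → ΔA Â) → Set (ℓ₁ ⊔ ℓ₂)
IsDerivative B̂ Â f ∂f = ∀ b δ → f (_⊕_ B̂ b δ) ≡ _⊕_ Â (f b) (∂f b δ)

Differentiable : ∀ {ℓ₁ ℓ₂} (B̂ : ChangeAction ℓ₁) (Â : ChangeAction ℓ₂)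
  → (A B̂ → A Â) → Set (ℓ₁ ⊔ ℓ₂)
Differentiable B̂ Â f = Σ (A B̂ → ΔA B̂ → ΔA Â) (IsDerivative B̂ Â f)

AllFunctionsDifferentiable : ∀ {ℓ} → ChangeAction ℓ → Set (suc ℓ)
AllFunctionsDifferentiable {ℓ} Â =
  ∀ (B̂ : ChangeAction ℓ) (f : A B̂ → A Â) → Differentiable B̂ Â f

-- A difference operator is exactly a choice of witnesses for transitivity, and
-- b ⊕ δ ↦ f (b ⊕ δ) ⊖ f b is then a derivative of any f. Conversely, to connect
-- a to b, differentiate the map false ↦ a, true ↦ b on the booleans acting on
-- themselves by disjunction: false ∨ true = true gives a ⊕ ∂f false true ≡ b.
module Submission where

open import Defs
open import Level using (Level; Lift; lift)
open import Data.Product using (_×_; _,_; proj₁; proj₂)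
open import Function.Base using (_∘_)
open import Function.Bundles using (_⇔_; mk⇔)
open import Data.Bool using (Bool; true; false; _∨_)
open import Data.Bool.Properties using (∨-assoc; ∨-identityʳ)
open import Relation.Binary.PropositionalEquality
  using (_≡_; refl; sym; cong; cong₂; isEquivalence)
open import Algebra.Structures using (IsMonoid)

regularChangeAction : ∀ {ℓ} {M : Set ℓ} {_∙_ : M → M → M} {ε : M} →
  IsMonoid _≡_ _∙_ ε → ChangeAction ℓ
regularChangeAction {M = M} {_∙_} {ε} isMonoid = record
  { A = M ; ΔA = M ; _⊕_ = _∙_ ; _+_ = _∙_ ; 0Δ = ε ; isMonoid = isMonoid
  ; ⊕-zero = identityʳ
  ; ⊕-plus = λ a δ₁ δ₂ → sym (assoc a δ₁ δ₂)
  }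
  where open IsMonoid isMonoid using (assoc; identityʳ)

module _ {ℓ : Level} where

  _∨↑_ : Lift ℓ Bool → Lift ℓ Bool → Lift ℓ Bool
  lift x ∨↑ lift y = lift (x ∨ y)

  ∨↑-isMonoid : IsMonoid _≡_ _∨↑_ (lift false)
  ∨↑-isMonoid = record
    { isSemigroup = record
      { isMagma = record { isEquivalence = isEquivalence ; ∙-cong = cong₂ _∨↑_ }
      ; assoc = λ { (lift x) (lift y) (lift z) → cong lift (∨-assoc x y z) }
      }
    ; identity = (λ _ → refl) , λ { (lift x) → cong lift (∨-identityʳ x) }
    }

module Implications {ℓ : Level} (Â : ChangeAction ℓ) where

  open ChangeAction Â using (_⊕_)

  transitive⇒hasDifferenceOperator : Transitive Â → HasDifferenceOperator Â
  transitive⇒hasDifferenceOperator connect =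
    (λ b a → proj₁ (connect a b)) , (λ a b → proj₂ (connect a b))

  hasDifferenceOperator⇒transitive : HasDifferenceOperator Â → Transitive Â
  hasDifferenceOperator⇒transitive (_⊖_ , ⊕-⊖) a b = b ⊖ a , ⊕-⊖ a b

  hasDifferenceOperator⇒allFunctionsDifferentiable :
    HasDifferenceOperator Â → AllFunctionsDifferentiable Â
  hasDifferenceOperator⇒allFunctionsDifferentiable (_⊖_ , ⊕-⊖) B̂ f =
    (λ b δ → f (b ⊕ᴮ δ) ⊖ f b) , λ b δ → sym (⊕-⊖ (f b) (f (b ⊕ᴮ δ)))
    where open ChangeAction B̂ using () renaming (_⊕_ to _⊕ᴮ_)

  allFunctionsDifferentiable⇒transitive :
    AllFunctionsDifferentiable Â → Transitive Â
  allFunctionsDifferentiable⇒transitive differentiable a b =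
    ∂f (lift false) (lift true) , sym (∂f-correct (lift false) (lift true))
    where
    f : Lift ℓ Bool → A Â
    f (lift false) = a
    f (lift true)  = b

    B̂ : ChangeAction ℓ
    B̂ = regularChangeAction ∨↑-isMonoid

    ∂f : Lift ℓ Bool → Lift ℓ Bool → ΔA Â
    ∂f = proj₁ (differentiable B̂ f)

    ∂f-correct : IsDerivative B̂ Â f ∂f
    ∂f-correct = proj₂ (differentiable B̂ f)

mainTheorem3 : ∀ {ℓ} (Â : ChangeAction ℓ) →
    (Transitive Â ⇔ HasDifferenceOperator Â)
    × (HasDifferenceOperator Â ⇔ AllFunctionsDifferentiable Â)
    × (AllFunctionsDifferentiable Â ⇔ Transitive Â)
mainTheorem3 Â =
  mk⇔ transitive⇒hasDifferenceOperator hasDifferenceOperator⇒transitive ,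
  mk⇔ hasDifferenceOperator⇒allFunctionsDifferentiable
      (transitive⇒hasDifferenceOperator ∘ allFunctionsDifferentiable⇒transitive) ,
  mk⇔ allFunctionsDifferentiable⇒transitive
      (hasDifferenceOperator⇒allFunctionsDifferentiable ∘ transitive⇒hasDifferenceOperator)
  where open Implications Â
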